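{- Let $\mathcal{C}$ be a clone on a nonempty set $A$, let $0<n<\omega$, let $f\colon A^n\to A$, and let $\lambda$ be a nonzero natural number. The following are equivalent: (i) $A^n$ has a finite cover $\mathcal{C}_\lambda\subseteq\mathcal{P}(A^n)$ such that whenever $\mathcal{B}\subseteq\mathcal{C}_\lambda$ satisfies $|\mathcal{B}|\le\lambda$, there exists an $n$-ary $t^{[\mathcal{B}]}\in\mathcal{C}$ with $f|_{\bigcup\mathcal{B}}=t^{[\mathcal{B}]}|_{\bigcup\mathcal{B}}$; (ii) $(A^n)^\lambda$ has a finite cover $\mathcal{D}_\lambda\subseteq\mathcal{P}((A^n)^\lambda)$ such that for every $D\in\mathcal{D}_\lambda$ there exists an $n$-ary $s^{[D]}\in\mathcal{C}$ with $f(a_i)=s^{[D]}(a_i)$ for all $i<\lambda$ whenever $[a_i]_{i<\lambda}\in D$; (iii) the family $\mathcal{F}_\lambda=\{N_t: t\in\mathcal{C}\text{ $n$-ary}\}$ of subsets of $(A^n)^\lambda$ fails to have the finite intersection property (i.e., some finite subfamily has empty intersection), where $N_t=(A^n)^\lambda\setminus E_t$ and $E_t=\{[a_i]_{i<\lambda}\in(A^n)^\lambda: f(a_i)=t(a_i)\text{ for all }i<\lambda\}$.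
   Context: A clone on a nonempty set $A$ is a set of finitary operations on $A$ that contains all projections and is closed under composition. A finite cover of a set $X$ is a finite set of subsets of $X$ whose union is $X$. Elements of $(A^n)^\lambda$ are $\lambda$-sequences $[a_i]_{i<\lambda}$ of elements $a_i\in A^n$. -}

module Defs where

open import Data.Nat using (ℕ; _≤_)
open import Data.Fin using (Fin)
open import Data.Product using (Σ; ∃; _×_; _,_)
open import Relation.Nullary using (¬_)
open import Relation.Binary.PropositionalEquality using (_≡_)

Op : Set → ℕ → Set
Op A k = (Fin k → A) → A

-- A clone on A: a set (predicate) of finitary operations, closed under
-- extensional equality (it is a set of functions), containing all
-- projections and closed under composition.
record IsClone {A : Set} (C : ∀ {k} → Op A k → Set) : Set₁ where
  field
    ext  : ∀ {k} (g h : Op A k) → (∀ x → g x ≡ h x) → C g → C h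
    proj : ∀ k (i : Fin k) → C {k} (λ x → x i)
    comp : ∀ k m (g : Op A m) (hs : Fin m → Op A k) →
           C g → (∀ j → C (hs j)) → C {k} (λ x → g (λ j → hs j x))

record FiniteCover (X : Set) : Set₁ where
  field
    size    : ℕ
    member  : Fin size → X → Set
    covers  : ∀ x → ∃ λ j → member j x
open FiniteCover public

Cond-i : {A : Set} (C : ∀ {k} → Op A k → Set) (n : ℕ) (f : Op A n) (λ' : ℕ) → Set₁
Cond-i {A} C n f λ' =
  Σ (FiniteCover (Fin n → A)) λ 𝒞 →
    -- a subfamily 𝓑 of size ≤ λ, listed as 𝒞 (g 0), …, 𝒞 (g (m-1))
    ∀ (m : ℕ) → m ≤ λ' → (g : Fin m → Fin (size 𝒞)) →
      Σ (Op A n) λ t → C t ×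
        (∀ x → (∃ λ j → member 𝒞 (g j) x) → f x ≡ t x)

Cond-ii : {A : Set} (C : ∀ {k} → Op A k → Set) (n : ℕ) (f : Op A n) (λ' : ℕ) → Set₁
Cond-ii {A} C n f λ' =
  Σ (FiniteCover (Fin λ' → Fin n → A)) λ 𝒟 →
    ∀ (D : Fin (size 𝒟)) →
      Σ (Op A n) λ s → C s ×
        (∀ a → member 𝒟 D a → ∀ i → f (a i) ≡ s (a i))

E : {A : Set} (n : ℕ) (f : Op A n) (λ' : ℕ) → Op A n → (Fin λ' → Fin n → A) → Set
E n f λ' t a = ∀ i → f (a i) ≡ t (a i)

N : {A : Set} (n : ℕ) (f : Op A n) (λ' : ℕ) → Op A n → (Fin λ' → Fin n → A) → Set
N n f λ' t a = ¬ E n f λ' t a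

Cond-iii : {A : Set} (C : ∀ {k} → Op A k → Set) (n : ℕ) (f : Op A n) (λ' : ℕ) → Set
Cond-iii {A} C n f λ' =
  Σ ℕ λ k → Σ (Fin k → Op A n) λ ts → (∀ j → C (ts j)) ×
    (∀ (a : Fin λ' → Fin n → A) → ¬ (∀ j → N n f λ' (ts j) a))

module Submission where

-- Finite covers indexed by functions Fin k → Fin b are built once, as
-- `coordinatewiseCover`; it yields both the λ-th power of a cover of A^n
-- (used for (i) ⇒ (ii)) and the cover of A^n by agreement patterns of f with
-- finitely many operations t₀, …, t_{k-1} (used for (iii) ⇒ (i)).
-- (ii) ⇔ (iii) is a reformulation: a cover as in (ii) is exactly a finite
-- family of sets E_t covering (A^n)^λ, i.e. of N_t with empty intersection.
-- For (iii) ⇒ (i), given at most λ pattern cells, choose a representative of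
-- each nonempty one and pad them to a point of (A^n)^λ; by (iii) some t_j
-- agrees with f on all representatives, hence on all of these cells, since
-- agreement with t_j is constant on a pattern cell.

open import Defs
open import Data.Nat using (ℕ; NonZero; _^_; _≤_; z≤n; s≤s)
open import Data.Nat.Properties using (≤-refl)
open import Data.Fin using (Fin; zero; suc; finToFun; funToFin)
open import Data.Fin.Properties using (finToFun-funToFin)
open import Data.Vec.Functional using (_∷_)
open import Data.Product using (_×_; _,_; proj₁; proj₂; Σ; ∃)
open import Data.Empty using (⊥-elim)
open import Function using (_∘_)
open import Function.Bundles using (_⇔_; mk⇔)
open import Axiom.ExcludedMiddle using (ExcludedMiddle)
open import Axiom.DoubleNegationElimination using (em⇒dne)
open import Level using (0ℓ)
open import Relation.Nullary using (yes; no; ¬_)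
open import Relation.Binary.PropositionalEquality using (_≡_; refl; sym; subst)

coordinatewiseCover : {X : Set} {k b : ℕ} (Q : Fin k → Fin b → X → Set) →
  (∀ x i → ∃ λ c → Q i c x) → FiniteCover X
coordinatewiseCover {k = k} {b} Q choose = record
  { size   = b ^ k
  ; member = λ c x → ∀ i → Q i (finToFun c i) x
  ; covers = λ x → funToFin (λ i → proj₁ (choose x i)) , λ i →
      subst (λ c → Q i c _) (sym (finToFun-funToFin _ i)) (proj₂ (choose x i))
  }

powerCover : {X : Set} → FiniteCover X → (λ' : ℕ) → FiniteCover (Fin λ' → X)
powerCover 𝒞 λ' =
  coordinatewiseCover (λ i c a → member 𝒞 c (a i)) (λ a i → covers 𝒞 (a i))

Holds : Fin 2 → Set → Set
Holds zero       P = P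
Holds (suc zero) P = ¬ P

truthValue : ExcludedMiddle 0ℓ → (P : Set) → ∃ λ c → Holds c P
truthValue lem P with lem {P}
... | yes p = zero , p
... | no ¬p = suc zero , ¬p

sameTruthValue : ∀ c {P P′ : Set} → Holds c P → Holds c P′ → P′ → P
sameTruthValue zero       p  _   _  = p
sameTruthValue (suc zero) _  ¬p′ p′ = ⊥-elim (¬p′ p′)

patternCover : ExcludedMiddle 0ℓ → {X : Set} {k : ℕ} → (Fin k → X → Set) →
  FiniteCover X
patternCover lem P =
  coordinatewiseCover (λ j c x → Holds c (P j x)) (λ x j → truthValue lem (P j x))

pattern-constant : (lem : ExcludedMiddle 0ℓ) {X : Set} {k : ℕ}
  (P : Fin k → X → Set) (c : Fin (size (patternCover lem P))) {x y : X} →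
  member (patternCover lem P) c x → member (patternCover lem P) c y →
  ∀ j → P j y → P j x
pattern-constant lem P c x∈c y∈c j = sameTruthValue (finToFun c j) (x∈c j) (y∈c j)

representative : ExcludedMiddle 0ℓ → {X : Set} → X → (S : X → Set) →
  Σ X λ x → ∃ S → S x
representative lem d S with lem {∃ S}
... | yes (x , Sx) = x , λ _ → Sx
... | no ¬∃S       = d , λ ∃S → ⊥-elim (¬∃S ∃S)

pad : {X : Set} {m l : ℕ} → m ≤ l → X → (Fin m → X) → Fin l → X
pad z≤n      d v = λ _ → d
pad (s≤s le) d v = v zero ∷ pad le d (v ∘ suc)

pad-contains : {X : Set} {m l : ℕ} (le : m ≤ l) (d : X) (v : Fin m → X) →
  ∀ k → ∃ λ i → pad le d v i ≡ v k
pad-contains (s≤s le) d v zero    = zero , refl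
pad-contains (s≤s le) d v (suc k) with pad-contains le d (v ∘ suc) k
... | i , eq = suc i , eq

module Conditions (lem : ExcludedMiddle 0ℓ) {A : Set} (a₀ : A)
  (C : ∀ {k} → Op A k → Set) (n : ℕ) (f : Op A n) (λ' : ℕ) where

  -- (i) ⇒ (ii): a block of the λ-th power of 𝒞 involves at most λ blocks
  -- of 𝒞, on whose union f agrees with some member of C.
  i⇒ii : Cond-i C n f λ' → Cond-ii C n f λ'
  i⇒ii (𝒞 , local) = powerCover 𝒞 λ' , λ D →
    let (t , t∈C , f≡t) = local λ' ≤-refl (finToFun D)
    in t , t∈C , λ a a∈D i → f≡t (a i) (i , a∈D i)

  -- (ii) ⇒ (iii): a point in every N_{s[D]} would lie in no block D.
  ii⇒iii : Cond-ii C n f λ' → Cond-iii C n f λ'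
  ii⇒iii (𝒟 , s) = size 𝒟 , (proj₁ ∘ s) , (proj₁ ∘ proj₂ ∘ s) , λ a a∈allN →
    let (D , a∈D) = covers 𝒟 a in a∈allN D (proj₂ (proj₂ (s D)) a a∈D)

  -- (iii) ⇒ (ii): the sets E_{t_j} cover (A^n)^λ.
  iii⇒ii : Cond-iii C n f λ' → Cond-ii C n f λ'
  iii⇒ii (k , ts , ts∈C , noPoint) =
    record { size = k ; member = E n f λ' ∘ ts
           ; covers = λ a → em⇒dne lem λ ¬∃ → noPoint a λ j a∈E → ¬∃ (j , a∈E) }
    , λ j → ts j , ts∈C j , λ _ a∈E → a∈E

  -- (iii) ⇒ (i): the cover of A^n by agreement patterns with t₀, …, t_{k-1}.
  iii⇒i : Cond-iii C n f λ' → Cond-i C n f λ'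
  iii⇒i (k , ts , ts∈C , noPoint) = 𝒞 , onBlocks
    where
    Agrees : Fin k → (Fin n → A) → Set
    Agrees j x = f x ≡ ts j x

    𝒞 : FiniteCover (Fin n → A)
    𝒞 = patternCover lem Agrees

    onBlocks : ∀ m → m ≤ λ' → (g : Fin m → Fin (size 𝒞)) →
      Σ (Op A n) λ t → C t × (∀ x → (∃ λ l → member 𝒞 (g l) x) → f x ≡ t x)
    onBlocks m le g = ts j , ts∈C j , λ x (l , x∈l) → agreesOnBlocks l x x∈l
      where
      rep : Fin m → Fin n → A
      rep l = proj₁ (representative lem (λ _ → a₀) (member 𝒞 (g l)))

      -- a point of (A^n)^λ containing a representative of every block
      a : Fin λ' → Fin n → A
      a = pad le (λ _ → a₀) rep

      agreesEverywhere : ∀ j → E n f λ' (ts j) a →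
        ∀ l x → member 𝒞 (g l) x → Agrees j x
      agreesEverywhere j a∈E l x x∈l =
        let (i , aᵢ≡rep) = pad-contains le (λ _ → a₀) rep l
            rep∈l = proj₂ (representative lem (λ _ → a₀) (member 𝒞 (g l))) (x , x∈l)
        in pattern-constant lem Agrees (g l) x∈l rep∈l j
             (subst (Agrees j) aᵢ≡rep (a∈E i))

      good : ∃ λ j → ∀ l x → member 𝒞 (g l) x → Agrees j x
      good = em⇒dne lem λ ¬good →
        noPoint a λ j a∈E → ¬good (j , agreesEverywhere j a∈E)

      j : Fin k
      j = proj₁ good

      agreesOnBlocks : ∀ l x → member 𝒞 (g l) x → Agrees j x
      agreesOnBlocks = proj₂ good

lemma3p3 : ExcludedMiddle 0ℓ → {A : Set} → A →
    (C : ∀ {k} → Op A k → Set) → IsClone C →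
    (n : ℕ) → .{{_ : NonZero n}} → (f : Op A n) →
    (λ' : ℕ) → .{{_ : NonZero λ'}} →
    (Cond-i C n f λ' ⇔ Cond-ii C n f λ') × (Cond-ii C n f λ' ⇔ Cond-iii C n f λ')
lemma3p3 lem a₀ C _ n f λ' =
  mk⇔ i⇒ii (iii⇒i ∘ ii⇒iii) , mk⇔ ii⇒iii iii⇒ii
  where open Conditions lem a₀ C n f λ'
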